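{- Let $A$ be a complete MV-algebra (an MV-frame). If $A$ is algebraic as a frame, then its Boolean center $B(A)$ is an algebraic Boolean frame, i.e. a complete Boolean algebra in which every element is the join of the compact elements of $B(A)$ below it.
   Context: An MV-frame is a complete MV-algebra regarded as a frame (it satisfies $x\wedge\bigvee X=\bigvee\{x\wedge y:y\in X\}$). The Boolean center $B(A)$ is the largest Boolean subalgebra of $A$. An element $a$ of a complete lattice $L$ is compact if whenever $a\le\bigvee S$ for $S\subseteq L$ there is a finite $F\subseteq S$ with $a\le\bigvee F$; $\mathfrak{k}(L)$ denotes the set of compact elements. $L$ is algebraic if every $a\in L$ satisfies $a=\bigvee\{x\in\mathfrak{k}(L):x\le a\}$. -}

module Defs where

open import Level using (Level; suc; _⊔_)
open import Relation.Binary.PropositionalEquality using (_≡_)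
open import Relation.Unary using (Pred; _∈_; _⊆_)
open import Data.Product using (Σ; ∃; _×_)
open import Data.List using (List)
import Data.List.Membership.Propositional as LM

record MVAlgebra (c : Level) : Set (suc c) where
  infixl 6 _⊕_
  infix 8 ¬_
  infixr 5 _∨_
  infixr 5 _∧_
  infix 4 _≤_
  field
    Carrier : Set c
    _⊕_     : Carrier → Carrier → Carrier
    ¬_      : Carrier → Carrier
    𝟘       : Carrier
    ⊕-assoc : ∀ x y z → (x ⊕ y) ⊕ z ≡ x ⊕ (y ⊕ z)
    ⊕-comm  : ∀ x y → x ⊕ y ≡ y ⊕ x
    ⊕-idʳ   : ∀ x → x ⊕ 𝟘 ≡ x
    ¬¬      : ∀ x → ¬ (¬ x) ≡ x
    ⊕-absorb : ∀ x → x ⊕ ¬ 𝟘 ≡ ¬ 𝟘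
    Łuk     : ∀ x y → ¬ (¬ x ⊕ y) ⊕ y ≡ ¬ (¬ y ⊕ x) ⊕ x

  𝟙 : Carrier
  𝟙 = ¬ 𝟘

  _∨_ : Carrier → Carrier → Carrier
  x ∨ y = ¬ (¬ x ⊕ y) ⊕ y

  _∧_ : Carrier → Carrier → Carrier
  x ∧ y = ¬ (¬ x ∨ ¬ y)

  _≤_ : Carrier → Carrier → Set c
  x ≤ y = ¬ x ⊕ y ≡ 𝟙

  IsLUB : ∀ {ℓ} → Pred Carrier ℓ → Carrier → Set (c ⊔ ℓ)
  IsLUB P u = (∀ x → P x → x ≤ u) × (∀ v → (∀ x → P x → x ≤ v) → u ≤ v)

  B : Pred Carrier c
  B x = x ⊕ x ≡ x

  IsLUB-B : ∀ {ℓ} → Pred Carrier ℓ → Carrier → Set (c ⊔ ℓ)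
  IsLUB-B P u = u ∈ B × (∀ x → P x → x ≤ u)
              × (∀ v → v ∈ B → (∀ x → P x → x ≤ v) → u ≤ v)

  _⊆fin_ : List Carrier → Pred Carrier c → Set c
  xs ⊆fin S = ∀ x → x LM.∈ xs → S x

-- complete MV-algebra, regarded as a frame (MV-frame):
-- all joins of subsets (of level c) exist and ∧ distributes over them.
record MVFrame (c : Level) : Set (suc c) where
  field
    mv : MVAlgebra c
  open MVAlgebra mv public
  field
    ⋁      : Pred Carrier c → Carrier
    ⋁-lub  : ∀ S → IsLUB S (⋁ S)
    frame-distrib : ∀ x (X : Pred Carrier c) →
      x ∧ ⋁ X ≡ ⋁ (λ z → ∃ λ y → X y × z ≡ x ∧ y)

  Compact : Carrier → Set (suc c)
  Compact a = ∀ (S : Pred Carrier c) → a ≤ ⋁ S →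
    ∃ λ (F : List Carrier) → F ⊆fin S × a ≤ ⋁ (λ x → x LM.∈ F)

  Algebraic : Set (suc c)
  Algebraic = ∀ a → IsLUB (λ x → Compact x × x ≤ a) a

  CompactB : Carrier → Set (suc c)
  CompactB a = ∀ (S : Pred Carrier c) → S ⊆ B → ∀ u → IsLUB-B S u → a ≤ u →
    ∃ λ (F : List Carrier) → F ⊆fin S ×
      (∃ λ w → IsLUB-B (λ x → x LM.∈ F) w × a ≤ w)

  CompleteB : Set (suc c)
  CompleteB = ∀ (S : Pred Carrier c) → S ⊆ B → ∃ λ u → IsLUB-B S u

  AlgebraicB : Set (suc c)
  AlgebraicB = ∀ a → a ∈ B → IsLUB-B (λ x → x ∈ B × CompactB x × x ≤ a) a

{-# OPTIONS --safe #-}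
module Submission where

-- An element x is Boolean iff x ∧ ¬ x = 𝟘, so frame distributivity makes B(A)
-- closed under arbitrary joins of A; joins in B(A) are therefore joins in A and
-- B(A) is complete. For a compact k of A let k* be the least Boolean element
-- above k. A Boolean cover of k* covers k in A, and the join of a finite
-- subcover is Boolean and above k, hence above k*: so k* is compact in B(A).
-- Finally a Boolean a is the join of the compact k ≤ a, and k ≤ k* ≤ a, so a is
-- also the join of the compact Boolean elements below it.

open import Defs
open import Level using (Level)
open import Data.Product using (_×_; _,_; proj₁; proj₂; ∃)
open import Relation.Unary using (Pred; _∈_; _⊆_)
open import Relation.Binary.PropositionalEquality
  using (_≡_; refl; sym; trans; cong; subst; module ≡-Reasoning)
import Data.List.Membership.Propositional as LM

module MVOrder {c : Level} (A : MVAlgebra c) where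
  open MVAlgebra A
  open ≡-Reasoning

  ⊕-identityˡ : ∀ x → 𝟘 ⊕ x ≡ x
  ⊕-identityˡ x = trans (⊕-comm 𝟘 x) (⊕-idʳ x)

  ⊕-zeroˡ : ∀ x → 𝟙 ⊕ x ≡ 𝟙
  ⊕-zeroˡ x = trans (⊕-comm 𝟙 x) (⊕-absorb x)

  ¬𝟙≡𝟘 : ¬ 𝟙 ≡ 𝟘
  ¬𝟙≡𝟘 = ¬¬ 𝟘

  ∨-comm : ∀ x y → x ∨ y ≡ y ∨ x
  ∨-comm = Łuk

  ∧-comm : ∀ x y → x ∧ y ≡ y ∧ x
  ∧-comm x y = cong ¬_ (∨-comm (¬ x) (¬ y))

  ≤-refl : ∀ x → x ≤ x
  ≤-refl x = begin
    ¬ x ⊕ x               ≡⟨ cong (λ t → ¬ t ⊕ x) (sym (⊕-identityˡ x)) ⟩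
    ¬ (𝟘 ⊕ x) ⊕ x         ≡⟨ cong (λ t → ¬ (t ⊕ x) ⊕ x) (sym ¬𝟙≡𝟘) ⟩
    ¬ (¬ 𝟙 ⊕ x) ⊕ x       ≡⟨ sym (Łuk x 𝟙) ⟩
    ¬ (¬ x ⊕ 𝟙) ⊕ 𝟙       ≡⟨ ⊕-absorb _ ⟩
    𝟙                     ∎

  ≤-reflexive : ∀ {x y} → x ≡ y → x ≤ y
  ≤-reflexive {x} refl = ≤-refl x

  𝟘≤x : ∀ x → 𝟘 ≤ x
  𝟘≤x = ⊕-zeroˡ

  x≤x⊕y : ∀ x y → x ≤ x ⊕ y
  x≤x⊕y x y = begin
    ¬ x ⊕ (x ⊕ y)   ≡⟨ sym (⊕-assoc (¬ x) x y) ⟩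
    (¬ x ⊕ x) ⊕ y   ≡⟨ cong (_⊕ y) (≤-refl x) ⟩
    𝟙 ⊕ y           ≡⟨ ⊕-zeroˡ y ⟩
    𝟙               ∎

  x≤y⇒x∨y≡y : ∀ {x y} → x ≤ y → x ∨ y ≡ y
  x≤y⇒x∨y≡y {x} {y} x≤y = begin
    ¬ (¬ x ⊕ y) ⊕ y   ≡⟨ cong (λ t → ¬ t ⊕ y) x≤y ⟩
    ¬ 𝟙 ⊕ y           ≡⟨ cong (_⊕ y) ¬𝟙≡𝟘 ⟩
    𝟘 ⊕ y             ≡⟨ ⊕-identityˡ y ⟩
    y                 ∎

  ≤-antisym : ∀ {x y} → x ≤ y → y ≤ x → x ≡ y
  ≤-antisym {x} {y} x≤y y≤x = begin
    x       ≡⟨ sym (x≤y⇒x∨y≡y y≤x) ⟩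
    y ∨ x   ≡⟨ ∨-comm y x ⟩
    x ∨ y   ≡⟨ x≤y⇒x∨y≡y x≤y ⟩
    y       ∎

  ≤⇒∃⊕ : ∀ {x y} → x ≤ y → ∃ λ d → y ≡ x ⊕ d
  ≤⇒∃⊕ {x} {y} x≤y = ¬ (¬ y ⊕ x) , (begin
    y                   ≡⟨ sym (x≤y⇒x∨y≡y x≤y) ⟩
    x ∨ y               ≡⟨ ∨-comm x y ⟩
    ¬ (¬ y ⊕ x) ⊕ x     ≡⟨ ⊕-comm _ x ⟩
    x ⊕ ¬ (¬ y ⊕ x)     ∎)

  ≤-trans : ∀ {x y z} → x ≤ y → y ≤ z → x ≤ z
  ≤-trans {x} x≤y y≤z with ≤⇒∃⊕ x≤y | ≤⇒∃⊕ y≤z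
  ... | d , refl | e , refl = subst (x ≤_) (sym (⊕-assoc x d e)) (x≤x⊕y x (d ⊕ e))

  ⊕-monoˡ-≤ : ∀ {x y} z → x ≤ y → x ⊕ z ≤ y ⊕ z
  ⊕-monoˡ-≤ {x} z x≤y with ≤⇒∃⊕ x≤y
  ... | d , refl = subst (x ⊕ z ≤_) x⊕z⊕d≡x⊕d⊕z (x≤x⊕y (x ⊕ z) d)
    where
    x⊕z⊕d≡x⊕d⊕z : (x ⊕ z) ⊕ d ≡ (x ⊕ d) ⊕ z
    x⊕z⊕d≡x⊕d⊕z = begin
      (x ⊕ z) ⊕ d   ≡⟨ ⊕-assoc x z d ⟩
      x ⊕ (z ⊕ d)   ≡⟨ cong (x ⊕_) (⊕-comm z d) ⟩
      x ⊕ (d ⊕ z)   ≡⟨ sym (⊕-assoc x d z) ⟩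
      (x ⊕ d) ⊕ z   ∎

  ¬-antitone : ∀ {x y} → x ≤ y → ¬ y ≤ ¬ x
  ¬-antitone {x} {y} x≤y = trans (cong (_⊕ ¬ x) (¬¬ y)) (trans (⊕-comm y (¬ x)) x≤y)

  x≤¬y⇒y≤¬x : ∀ {x y} → x ≤ ¬ y → y ≤ ¬ x
  x≤¬y⇒y≤¬x {x} {y} x≤¬y = subst (_≤ ¬ x) (¬¬ y) (¬-antitone x≤¬y)

  ¬x≤y⇒¬y≤x : ∀ {x y} → ¬ x ≤ y → ¬ y ≤ x
  ¬x≤y⇒¬y≤x {x} {y} ¬x≤y = subst (¬ y ≤_) (¬¬ x) (¬-antitone ¬x≤y)

  ∧-monoˡ-≤ : ∀ {x x′} y → x ≤ x′ → x ∧ y ≤ x′ ∧ y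
  ∧-monoˡ-≤ y x≤x′ = ¬-antitone (⊕-monoˡ-≤ _ (¬-antitone (⊕-monoˡ-≤ (¬ y) (¬-antitone (¬-antitone x≤x′)))))

  x∧¬x≡¬[¬[x⊕x]⊕x] : ∀ x → x ∧ ¬ x ≡ ¬ (¬ (x ⊕ x) ⊕ x)
  x∧¬x≡¬[¬[x⊕x]⊕x] x = cong (λ t → ¬ (¬ (t ⊕ t) ⊕ t)) (¬¬ x)

  B⇒x∧¬x≡𝟘 : ∀ {x} → x ∈ B → x ∧ ¬ x ≡ 𝟘
  B⇒x∧¬x≡𝟘 {x} x⊕x≡x = begin
    x ∧ ¬ x                 ≡⟨ x∧¬x≡¬[¬[x⊕x]⊕x] x ⟩
    ¬ (¬ (x ⊕ x) ⊕ x)       ≡⟨ cong (λ t → ¬ (¬ t ⊕ x)) x⊕x≡x ⟩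
    ¬ (¬ x ⊕ x)             ≡⟨ cong ¬_ (≤-refl x) ⟩
    ¬ 𝟙                     ≡⟨ ¬𝟙≡𝟘 ⟩
    𝟘                       ∎

  x∧¬x≡𝟘⇒B : ∀ {x} → x ∧ ¬ x ≡ 𝟘 → x ∈ B
  x∧¬x≡𝟘⇒B {x} x∧¬x≡𝟘 = ≤-antisym x⊕x≤x (x≤x⊕y x x)
    where
    x⊕x≤x : x ⊕ x ≤ x
    x⊕x≤x = trans (sym (¬¬ _)) (cong ¬_ (trans (sym (x∧¬x≡¬[¬[x⊕x]⊕x] x)) x∧¬x≡𝟘))

  ¬-B : ∀ {x} → x ∈ B → ¬ x ∈ B
  ¬-B {x} x∈B = x∧¬x≡𝟘⇒B (begin
    ¬ x ∧ ¬ ¬ x   ≡⟨ cong (¬ x ∧_) (¬¬ x) ⟩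
    ¬ x ∧ x       ≡⟨ ∧-comm (¬ x) x ⟩
    x ∧ ¬ x       ≡⟨ B⇒x∧¬x≡𝟘 x∈B ⟩
    𝟘             ∎)

module BooleanCenter {c : Level} (A : MVFrame c) where
  open MVFrame A
  open MVOrder mv

  ⋁-B : ∀ {S} → S ⊆ B → ⋁ S ∈ B
  ⋁-B {S} S⊆B = x∧¬x≡𝟘⇒B (trans (∧-comm s (¬ s)) (trans (frame-distrib (¬ s) S)
    (≤-antisym (proj₂ (⋁-lub _) 𝟘 ¬s∧S≤𝟘) (𝟘≤x _))))
    where
    s = ⋁ S
    ¬s∧S≤𝟘 : ∀ z → (∃ λ y → S y × z ≡ ¬ s ∧ y) → z ≤ 𝟘
    ¬s∧S≤𝟘 _ (y , y∈S , refl) = ≤-trans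
      (∧-monoˡ-≤ y (¬-antitone (proj₁ (⋁-lub S) y y∈S)))
      (≤-reflexive (trans (∧-comm (¬ y) y) (B⇒x∧¬x≡𝟘 (S⊆B y∈S))))

  ⋁-isLUB-B : ∀ {S} → S ⊆ B → IsLUB-B S (⋁ S)
  ⋁-isLUB-B {S} S⊆B = ⋁-B S⊆B , proj₁ (⋁-lub S) , λ v _ → proj₂ (⋁-lub S) v

  isLUB-B⇒≤⋁ : ∀ {S u} → S ⊆ B → IsLUB-B S u → u ≤ ⋁ S
  isLUB-B⇒≤⋁ {S} S⊆B (_ , _ , least) = least (⋁ S) (⋁-B S⊆B) (proj₁ (⋁-lub S))

  completeB : CompleteB
  completeB S S⊆B = ⋁ S , ⋁-isLUB-B S⊆B

  -- The least Boolean element ⋀ {b ∈ B(A) | k ≤ b} above k, written as a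
  -- complemented join since A only provides joins.
  complementsAbove : Carrier → Pred Carrier c
  complementsAbove k z = ∃ λ b → b ∈ B × k ≤ b × z ≡ ¬ b

  hull : Carrier → Carrier
  hull k = ¬ ⋁ (complementsAbove k)

  hull-B : ∀ k → hull k ∈ B
  hull-B k = ¬-B (⋁-B complementsAbove⊆B)
    where
    complementsAbove⊆B : complementsAbove k ⊆ B
    complementsAbove⊆B (b , b∈B , _ , refl) = ¬-B b∈B

  x≤hull : ∀ k → k ≤ hull k
  x≤hull k = x≤¬y⇒y≤¬x (proj₂ (⋁-lub (complementsAbove k)) (¬ k)
    λ { _ (b , _ , k≤b , refl) → ¬-antitone k≤b })

  hull-least : ∀ {k b} → b ∈ B → k ≤ b → hull k ≤ b
  hull-least {k} {b} b∈B k≤b =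
    ¬x≤y⇒¬y≤x (proj₁ (⋁-lub (complementsAbove k)) (¬ b) (b , b∈B , k≤b , refl))

  compact⇒hull-compactB : ∀ {k} → Compact k → CompactB (hull k)
  compact⇒hull-compactB {k} k-compact S S⊆B u u-lub hull≤u
    with k-compact S (≤-trans (x≤hull k) (≤-trans hull≤u (isLUB-B⇒≤⋁ S⊆B u-lub)))
  ... | F , F⊆S , k≤⋁F =
    F , F⊆S , ⋁ (LM._∈ F) , ⋁-isLUB-B F⊆B , hull-least (⋁-B F⊆B) k≤⋁F
    where
    F⊆B : (LM._∈ F) ⊆ B
    F⊆B x∈F = S⊆B (F⊆S _ x∈F)

  algebraic⇒algebraicB : Algebraic → AlgebraicB
  algebraic⇒algebraicB algebraic a a∈B = a∈B , (λ { _ (_ , _ , x≤a) → x≤a }) , least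
    where
    least : ∀ v → v ∈ B → (∀ x → x ∈ B × CompactB x × x ≤ a → x ≤ v) → a ≤ v
    least v _ bounds = proj₂ (algebraic a) v λ k (k-compact , k≤a) →
      ≤-trans (x≤hull k)
        (bounds (hull k) (hull-B k , compact⇒hull-compactB k-compact , hull-least a∈B k≤a))

proposition2p2 : ∀ {c : Level} (A : MVFrame c) →
                   MVFrame.Algebraic A →
                   MVFrame.CompleteB A × MVFrame.AlgebraicB A
proposition2p2 A algebraic = completeB , algebraic⇒algebraicB algebraic
  where open BooleanCenter A
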